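{- Let $M$ be odd and $n$ a positive integer, and let $d=\mathcal D(n,M)$. Then there exists a multilinear polynomial $f(x_1,\dots,x_d)$ with integer coefficients and at most $n+1$ monomials that represents $\mathsf{OR}_d\bmod M$ over $\{ -1,1\}^d$. Conversely, if a multilinear polynomial with integer coefficients and $n$ monomials represents $\mathsf{OR}_d\bmod M$ over $\{ -1,1\}^d$, then $\mathcal D(n',M)\ge d$ for some $n'\le M\cdot n$.
   Context: A polynomial $p(x_1,\dots,x_d)$ with integer coefficients represents $\mathsf{OR}_d\bmod M$ over $\{ -1,1\}^d$ if $p(\mathbf 1)\equiv0\pmod M$ and $p(x)\not\equiv0\pmod M$ for all $x\in\{ -1,1\}^d\setminus\{\mathbf 1\}$, where $\mathbf 1$ is the all-ones vector. $\mathcal D(n,M)$ denotes the largest dimension of an affine subspace $C$ of $\mathbb F_2^n$ such that for some $0\le a\le M$ there exists exactly one point $x_0\in C$ whose Hamming weight is $\equiv a\pmod M$. -}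

module Defs where

open import Data.Bool using (Bool; true; false; _xor_; if_then_else_)
open import Data.Nat using (ℕ; zero; suc; _≤_; _+_)
open import Data.Integer as ℤ using (ℤ; +_; -_)
open import Data.Integer.Divisibility using (_∣_)
open import Data.Vec using (Vec; []; _∷_; replicate; zipWith)
open import Data.List as List using (List; _++_; filter; length)
open import Data.Product using (Σ; ∃; _×_; _,_)
open import Relation.Binary.PropositionalEquality using (_≡_; _≢_)
open import Relation.Nullary using (¬_)
open import Relation.Nullary.Decidable using (¬?)

-- Points of {-1,1}^d : a vector of booleans, false ↦ 1, true ↦ -1.

pm : Bool → ℤ
pm false = + 1
pm true  = - (+ 1)

ones : (d : ℕ) → Vec Bool d
ones d = replicate d false

allVecs : (d : ℕ) → List (Vec Bool d)
allVecs zero    = [] List.∷ List.[]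
allVecs (suc d) = List.map (false ∷_) (allVecs d) ++ List.map (true ∷_) (allVecs d)

-- Multilinear polynomials in x₁..x_d with integer coefficients:
-- a coefficient for each squarefree monomial ∏_{i ∈ S} x_i,
-- S ⊆ {1..d} given by its indicator vector.

MLPoly : ℕ → Set
MLPoly d = Vec Bool d → ℤ

monoVal : ∀ {d} → Vec Bool d → Vec Bool d → ℤ
monoVal []          []       = + 1
monoVal (false ∷ S) (_ ∷ x)  = monoVal S x
monoVal (true ∷ S)  (b ∷ x)  = pm b ℤ.* monoVal S x

sumℤ : List ℤ → ℤ
sumℤ = List.foldr ℤ._+_ (+ 0)

eval : ∀ {d} → MLPoly d → Vec Bool d → ℤ
eval {d} f x = sumℤ (List.map (λ S → f S ℤ.* monoVal S x) (allVecs d))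

numMonomials : ∀ {d} → MLPoly d → ℕ
numMonomials {d} f = length (filter (λ S → ¬? (f S ℤ.≟ + 0)) (allVecs d))

RepresentsOR : (d M : ℕ) → MLPoly d → Set
RepresentsOR d M f =
  ((+ M) ∣ eval f (ones d)) ×
  (∀ (x : Vec Bool d) → x ≢ ones d → ¬ ((+ M) ∣ eval f x))

_⊕_ : ∀ {n} → Vec Bool n → Vec Bool n → Vec Bool n
_⊕_ = zipWith _xor_

zeroV : (n : ℕ) → Vec Bool n
zeroV n = replicate n false

weight : ∀ {n} → Vec Bool n → ℕ
weight []          = 0
weight (false ∷ x) = weight x
weight (true ∷ x)  = suc (weight x)

lincomb : ∀ {n k} → Vec Bool k → Vec (Vec Bool n) k → Vec Bool n
lincomb {n} []          []       = zeroV n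
lincomb     (false ∷ c) (_ ∷ bs) = lincomb c bs
lincomb     (true ∷ c)  (b ∷ bs) = b ⊕ lincomb c bs

record AffSub (n k : ℕ) : Set where
  field
    base  : Vec Bool n
    dirs  : Vec (Vec Bool n) k
    indep : ∀ (c : Vec Bool k) → lincomb c dirs ≡ zeroV n → c ≡ zeroV k

_∈A_ : ∀ {n k} → Vec Bool n → AffSub n k → Set
x ∈A C = ∃ λ c → x ≡ AffSub.base C ⊕ lincomb c (AffSub.dirs C)

_≡w_[mod_] : ℕ → ℕ → ℕ → Set
w ≡w a [mod M ] = (+ M) ∣ ((+ w) ℤ.- (+ a))

Good : (n M k : ℕ) → Set
Good n M k =
  Σ (AffSub n k) λ C → Σ ℕ λ a → a ≤ M ×
    Σ (Vec Bool n) λ x₀ → x₀ ∈A C × weight x₀ ≡w a [mod M ] ×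
      (∀ y → y ∈A C → weight y ≡w a [mod M ] → y ≡ x₀)

IsD : (n M d : ℕ) → Set
IsD n M d = Good n M d × (∀ k → Good n M k → k ≤ d)

OddNat : ℕ → Set
OddNat M = Σ ℕ λ k → M ≡ suc (k + k)

-- Parametrise the affine subspace as x ↦ x₀ ⊕ Bx with B injective.
-- Each coordinate of Bx is an inner product ⟨S, x⟩, and (−1)^⟨S,x⟩ is the value
-- of the monomial ∏_{i ∈ S} xᵢ at the point of {−1,1}ᵈ encoded by x (so x = 0
-- is 𝟏).  Hence the sum of the signs of the coordinates of x₀ ⊕ Bx, which is
-- n − 2·wt(x₀ ⊕ Bx), is a polynomial with n monomials; adding the constant
-- 2a − n gives f(x) = 2(a − wt(x₀ ⊕ Bx)).  As 2 is invertible modulo the odd M,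
-- M ∣ f(x) iff wt(x₀ ⊕ Bx) ≡ a, which by uniqueness of x₀ happens only at x = 0.
-- Conversely, reduce the coefficients of f into [0, M) and list every monomial
-- S as often as its reduced coefficient; these n' ≤ M·n columns define a linear
-- map B with f(x) ≡ n' − 2·wt(Bx) (mod M).  Evaluating at 𝟏 gives M ∣ n', so
-- M ∣ f(x) iff wt(Bx) ≡ 0, and since f represents OR only x = 0 qualifies: B is
-- injective and its image has a unique point of weight ≡ 0.  Dimensions are at
-- most n' and the property is decidable, so the largest dimension 𝒟(n', M) ≥ d
-- exists.

module Submission where

open import Defs
open import Data.Nat using (ℕ; _≤_; _*_; _+_)
open import Data.Product using (Σ; _×_)
open import Relation.Binary.PropositionalEquality using (_≡_)

open import Algebra.Bundles using (AbelianGroup)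
open import Algebra.Structures using (IsAbelianGroup)
import Algebra.Properties.AbelianGroup as AbelianGroupProperties
import Algebra.Properties.CommutativeSemigroup as CommutativeSemigroupProperties
open import Data.Bool as Bool using (Bool; true; false; _xor_; if_then_else_)
open import Data.Bool.Properties using (xor-assoc; xor-comm; xor-identityˡ; xor-identityʳ; xor-same)
open import Data.Fin as Fin using (Fin; toℕ; fromℕ<)
open import Data.Fin.Properties using (any?; all?; toℕ≤pred[n]; toℕ-fromℕ<; injective⇒≤; 2↔Bool; *↔×)
open import Data.Integer as ℤ using (ℤ; +_; -_)
import Data.Integer.Properties as ℤ
open import Data.Integer.Coprimality using (coprime-divisor)
open import Data.Integer.Divisibility using (_∣_)
import Data.Integer.Divisibility.Signed as Signed
open import Data.Integer.Divisibility.Signed using (∣ᵤ⇒∣; ∣⇒∣ᵤ)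
open import Data.Integer.DivMod using (_%ℕ_; _/ℕ_; a≡a%ℕn+[a/ℕn]*n; n%ℕd<d)
open import Data.Integer.Tactic.RingSolver using (solve-∀)
open import Data.List as List using (List)
open import Data.List.Properties using (map-∘)
open import Data.Nat as ℕ using (NonZero; zero; suc; z≤n; s≤s; _^_)
import Data.Nat.Properties as ℕ
open import Data.Nat.Coprimality using (Coprime; coprime-+; gcd≡1⇒coprime)
import Data.Nat.Divisibility as ℕ
open import Data.Nat.DivMod using (m*n%n≡0)
open import Data.Nat.ListAction using (sum)
open import Data.Product using (∃; _,_; proj₁; proj₂)
open import Data.Product.Function.NonDependent.Propositional using (_×-↔_)
open import Data.Vec as Vec using (Vec; []; _∷_; map; replicate; zipWith; transpose; _++_)
import Data.Vec.Properties as Vec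
open import Function using (_∘_; id; _⇔_; mk⇔; _↔_; mk↔ₛ′; Inverse; Equivalence; Injection)
open import Function.Properties.Inverse using (↔-sym; ↔-trans; ↔⇒↣)
open import Level using (0ℓ)
open import Relation.Binary.PropositionalEquality
  using (_≢_; refl; sym; trans; cong; cong₂; subst; isEquivalence; module ≡-Reasoning)
open import Relation.Nullary using (Dec; yes; no; ¬_; does; contradiction)
open import Relation.Nullary.Decidable as Dec using (_×-dec_; _→-dec_; decidable-stable)
open import Relation.Unary using (Pred; Decidable)

private
  variable
    A B : Set
    d k m n : ℕ

-- The vector space 𝔽₂ⁿ

⊕-self : (u : Vec Bool n) → u ⊕ u ≡ zeroV n
⊕-self []      = refl
⊕-self (b ∷ u) = cong₂ _∷_ (xor-same b) (⊕-self u)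

⊕-isAbelianGroup : ∀ n → IsAbelianGroup _≡_ (_⊕_ {n}) (zeroV n) id
⊕-isAbelianGroup n = record
  { isGroup = record
    { isMonoid = record
      { isSemigroup = record
        { isMagma  = record { isEquivalence = isEquivalence ; ∙-cong = cong₂ _⊕_ }
        ; assoc    = Vec.zipWith-assoc xor-assoc
        }
      ; identity = Vec.zipWith-identityˡ xor-identityˡ , Vec.zipWith-identityʳ xor-identityʳ
      }
    ; inverse = ⊕-self , ⊕-self
    ; ⁻¹-cong = id
    }
  ; comm = Vec.zipWith-comm xor-comm
  }

⊕-abelianGroup : ℕ → AbelianGroup 0ℓ 0ℓ
⊕-abelianGroup n = record { isAbelianGroup = ⊕-isAbelianGroup n }

module 𝔽₂ {n : ℕ} where
  open AbelianGroup (⊕-abelianGroup n) public using (identityˡ; identityʳ; assoc; comm)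
  open AbelianGroupProperties (⊕-abelianGroup n) public using (∙-cancelˡ; x∙y⁻¹≈ε⇒x≈y)
  open CommutativeSemigroupProperties (AbelianGroup.commutativeSemigroup (⊕-abelianGroup n)) public
    using (interchange)

lincomb-zero : (bs : Vec (Vec Bool n) k) → lincomb (zeroV k) bs ≡ zeroV n
lincomb-zero []       = refl
lincomb-zero (_ ∷ bs) = lincomb-zero bs

lincomb-⊕ : (c c′ : Vec Bool k) (bs : Vec (Vec Bool n) k) →
            lincomb (c ⊕ c′) bs ≡ lincomb c bs ⊕ lincomb c′ bs
lincomb-⊕ []          []           []       = sym (⊕-self _)
lincomb-⊕ (false ∷ c) (false ∷ c′) (b ∷ bs) = lincomb-⊕ c c′ bs
lincomb-⊕ (true ∷ c)  (false ∷ c′) (b ∷ bs) =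
  trans (cong (b ⊕_) (lincomb-⊕ c c′ bs)) (sym (𝔽₂.assoc b _ _))
lincomb-⊕ (false ∷ c) (true ∷ c′)  (b ∷ bs) = begin
  b ⊕ lincomb (c ⊕ c′) bs    ≡⟨ cong (b ⊕_) (lincomb-⊕ c c′ bs) ⟩
  b ⊕ (L ⊕ L′)               ≡⟨ sym (𝔽₂.assoc b L L′) ⟩
  (b ⊕ L) ⊕ L′               ≡⟨ cong (_⊕ L′) (𝔽₂.comm b L) ⟩
  (L ⊕ b) ⊕ L′               ≡⟨ 𝔽₂.assoc L b L′ ⟩
  L ⊕ (b ⊕ L′)               ∎
  where
  open ≡-Reasoning
  L = lincomb c bs
  L′ = lincomb c′ bs
lincomb-⊕ (true ∷ c)  (true ∷ c′)  (b ∷ bs) = begin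
  lincomb (c ⊕ c′) bs        ≡⟨ lincomb-⊕ c c′ bs ⟩
  L ⊕ L′                     ≡⟨ sym (𝔽₂.identityˡ (L ⊕ L′)) ⟩
  zeroV _ ⊕ (L ⊕ L′)         ≡⟨ cong (_⊕ (L ⊕ L′)) (sym (⊕-self b)) ⟩
  (b ⊕ b) ⊕ (L ⊕ L′)         ≡⟨ 𝔽₂.interchange b b L L′ ⟩
  (b ⊕ L) ⊕ (b ⊕ L′)         ∎
  where
  open ≡-Reasoning
  L = lincomb c bs
  L′ = lincomb c′ bs

lincomb-injective : {bs : Vec (Vec Bool n) k} →
                    (∀ c → lincomb c bs ≡ zeroV n → c ≡ zeroV k) →
                    ∀ {c c′} → lincomb c bs ≡ lincomb c′ bs → c ≡ c′
lincomb-injective {bs = bs} indep {c} {c′} eq = 𝔽₂.x∙y⁻¹≈ε⇒x≈y c c′ (indep (c ⊕ c′) (begin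
  lincomb (c ⊕ c′) bs          ≡⟨ lincomb-⊕ c c′ bs ⟩
  lincomb c bs ⊕ lincomb c′ bs ≡⟨ cong (_⊕ lincomb c′ bs) eq ⟩
  lincomb c′ bs ⊕ lincomb c′ bs ≡⟨ ⊕-self _ ⟩
  zeroV _                      ∎))
  where open ≡-Reasoning

infix 7 _·_
_·_ : Vec Bool d → Vec Bool d → Bool
[]          · []      = false
(false ∷ S) · (_ ∷ x) = S · x
(true ∷ S)  · (b ∷ x) = b xor (S · x)

lincomb-zipWith-∷ : (x c : Vec Bool k) (bs : Vec (Vec Bool n) k) →
                    lincomb x (zipWith _∷_ c bs) ≡ (c · x) ∷ lincomb x bs
lincomb-zipWith-∷ []          []          []       = refl
lincomb-zipWith-∷ (false ∷ x) (false ∷ c) (_ ∷ bs) = lincomb-zipWith-∷ x c bs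
lincomb-zipWith-∷ (false ∷ x) (true ∷ c)  (_ ∷ bs) = lincomb-zipWith-∷ x c bs
lincomb-zipWith-∷ (true ∷ x)  (false ∷ c) (b ∷ bs) = cong ((false ∷ b) ⊕_) (lincomb-zipWith-∷ x c bs)
lincomb-zipWith-∷ (true ∷ x)  (true ∷ c)  (b ∷ bs) = cong ((true ∷ b) ⊕_) (lincomb-zipWith-∷ x c bs)

transpose-∷ : (r : Vec A n) (rs : Vec (Vec A n) m) → transpose (r ∷ rs) ≡ zipWith _∷_ r (transpose rs)
transpose-∷ r rs = sym (Vec.zipWith-is-⊛ _∷_ r (transpose rs))

lincomb-transpose : (x : Vec Bool k) (rows : Vec (Vec Bool k) n) →
                    lincomb x (transpose rows) ≡ map (_· x) rows
lincomb-transpose x []         with lincomb x (transpose [])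
... | [] = refl
lincomb-transpose x (r ∷ rows) = begin
  lincomb x (transpose (r ∷ rows))           ≡⟨ cong (lincomb x) (transpose-∷ r rows) ⟩
  lincomb x (zipWith _∷_ r (transpose rows)) ≡⟨ lincomb-zipWith-∷ x r (transpose rows) ⟩
  (r · x) ∷ lincomb x (transpose rows)       ≡⟨ cong (r · x ∷_) (lincomb-transpose x rows) ⟩
  (r · x) ∷ map (_· x) rows                  ∎
  where open ≡-Reasoning

transpose-zipWith-∷ : (c : Vec A n) (rs : Vec (Vec A m) n) →
                      transpose (zipWith _∷_ c rs) ≡ c ∷ transpose rs
transpose-zipWith-∷ []      []       = refl
transpose-zipWith-∷ (a ∷ c) (r ∷ rs) = begin
  transpose ((a ∷ r) ∷ zipWith _∷_ c rs)                ≡⟨ transpose-∷ (a ∷ r) (zipWith _∷_ c rs) ⟩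
  zipWith _∷_ (a ∷ r) (transpose (zipWith _∷_ c rs))    ≡⟨ cong (zipWith _∷_ (a ∷ r)) (transpose-zipWith-∷ c rs) ⟩
  (a ∷ c) ∷ zipWith _∷_ r (transpose rs)                ≡⟨ cong ((a ∷ c) ∷_) (sym (transpose-∷ r rs)) ⟩
  (a ∷ c) ∷ transpose (r ∷ rs)                          ∎
  where open ≡-Reasoning

transpose-involutive : (rs : Vec (Vec A n) m) → transpose (transpose rs) ≡ rs
transpose-involutive []       = Vec.transpose-replicate []
transpose-involutive (r ∷ rs) = begin
  transpose (transpose (r ∷ rs))           ≡⟨ cong transpose (transpose-∷ r rs) ⟩
  transpose (zipWith _∷_ r (transpose rs)) ≡⟨ transpose-zipWith-∷ r (transpose rs) ⟩
  r ∷ transpose (transpose rs)             ≡⟨ cong (r ∷_) (transpose-involutive rs) ⟩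
  r ∷ rs                                   ∎
  where open ≡-Reasoning

lincomb≡map-·-transpose : (x : Vec Bool k) (bs : Vec (Vec Bool n) k) →
                          lincomb x bs ≡ map (_· x) (transpose bs)
lincomb≡map-·-transpose x bs =
  trans (cong (lincomb x) (sym (transpose-involutive bs))) (lincomb-transpose x (transpose bs))

pm-xor : ∀ a b → pm (a xor b) ≡ pm a ℤ.* pm b
pm-xor false false = refl
pm-xor false true  = refl
pm-xor true  false = refl
pm-xor true  true  = refl

monoVal-· : (S x : Vec Bool d) → monoVal S x ≡ pm (S · x)
monoVal-· []          []      = refl
monoVal-· (false ∷ S) (_ ∷ x) = monoVal-· S x
monoVal-· (true ∷ S)  (b ∷ x) = trans (cong (ℤ._*_ (pm b)) (monoVal-· S x)) (sym (pm-xor b (S · x)))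

monoVal-zeroV : (x : Vec Bool d) → monoVal (zeroV d) x ≡ + 1
monoVal-zeroV []      = refl
monoVal-zeroV (_ ∷ x) = monoVal-zeroV x

signSum : Vec Bool n → ℤ
signSum []      = + 0
signSum (b ∷ v) = pm b ℤ.+ signSum v

signSum-weight : (v : Vec Bool n) → signSum v ≡ + n ℤ.- + 2 ℤ.* + weight v
signSum-weight []              = refl
signSum-weight {suc n} (false ∷ v) =
  trans (cong (ℤ._+_ (+ 1)) (signSum-weight v)) (shift (+ n) (+ weight v))
  where
  shift : ∀ n w → + 1 ℤ.+ (n ℤ.- + 2 ℤ.* w) ≡ (+ 1 ℤ.+ n) ℤ.- + 2 ℤ.* w
  shift = solve-∀
signSum-weight {suc n} (true ∷ v) =
  trans (cong (ℤ._+_ (- + 1)) (signSum-weight v)) (shift (+ n) (+ weight v))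
  where
  shift : ∀ n w → - + 1 ℤ.+ (n ℤ.- + 2 ℤ.* w) ≡ (+ 1 ℤ.+ n) ℤ.- + 2 ℤ.* (+ 1 ℤ.+ w)
  shift = solve-∀

signSum-zeroV : ∀ n → signSum (zeroV n) ≡ + n
signSum-zeroV zero    = refl
signSum-zeroV (suc n) = cong (ℤ._+_ (+ 1)) (signSum-zeroV n)

signSum-++ : (u : Vec Bool m) (v : Vec Bool n) → signSum (u ++ v) ≡ signSum u ℤ.+ signSum v
signSum-++ []      v = sym (ℤ.+-identityˡ (signSum v))
signSum-++ (b ∷ u) v = trans (cong (ℤ._+_ (pm b)) (signSum-++ u v)) (sym (ℤ.+-assoc (pm b) _ _))

signSum-replicate : ∀ m b → signSum (replicate m b) ≡ + m ℤ.* pm b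
signSum-replicate zero    b = sym (ℤ.*-zeroˡ (pm b))
signSum-replicate (suc m) b = trans (cong (ℤ._+_ (pm b)) (signSum-replicate m b)) (distrib (+ m) (pm b))
  where
  distrib : ∀ m p → p ℤ.+ m ℤ.* p ≡ (+ 1 ℤ.+ m) ℤ.* p
  distrib = solve-∀

∑ : (A → ℤ) → List A → ℤ
∑ g xs = sumℤ (List.map g xs)

∑-++ : (g : A → ℤ) (xs ys : List A) → ∑ g (xs List.++ ys) ≡ ∑ g xs ℤ.+ ∑ g ys
∑-++ g List.[]         ys = sym (ℤ.+-identityˡ (∑ g ys))
∑-++ g (x List.∷ xs) ys = trans (cong (ℤ._+_ (g x)) (∑-++ g xs ys)) (sym (ℤ.+-assoc (g x) _ _))

∑-map : (g : B → ℤ) (h : A → B) (xs : List A) → ∑ g (List.map h xs) ≡ ∑ (g ∘ h) xs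
∑-map g h xs = cong sumℤ (sym (map-∘ xs))

∑-cong : {g h : A → ℤ} → (∀ x → g x ≡ h x) → (xs : List A) → ∑ g xs ≡ ∑ h xs
∑-cong g≡h List.[]         = refl
∑-cong g≡h (x List.∷ xs) = cong₂ ℤ._+_ (g≡h x) (∑-cong g≡h xs)

∑-+ : (g h : A → ℤ) (xs : List A) → ∑ (λ x → g x ℤ.+ h x) xs ≡ ∑ g xs ℤ.+ ∑ h xs
∑-+ g h List.[]         = refl
∑-+ g h (x List.∷ xs) = trans (cong (ℤ._+_ (g x ℤ.+ h x)) (∑-+ g h xs)) (interchange (g x) (h x) _ _)
  where
  interchange : ∀ a b c e → (a ℤ.+ b) ℤ.+ (c ℤ.+ e) ≡ (a ℤ.+ c) ℤ.+ (b ℤ.+ e)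
  interchange = solve-∀

∑-zero : {g : A → ℤ} → (∀ x → g x ≡ + 0) → (xs : List A) → ∑ g xs ≡ + 0
∑-zero g≡0 List.[]         = refl
∑-zero g≡0 (x List.∷ xs) = cong₂ ℤ._+_ (g≡0 x) (∑-zero g≡0 xs)

∑-allVecs : (g : Vec Bool (suc d) → ℤ) →
            ∑ g (allVecs (suc d)) ≡ ∑ (g ∘ (false ∷_)) (allVecs d) ℤ.+ ∑ (g ∘ (true ∷_)) (allVecs d)
∑-allVecs {d} g = trans (∑-++ g (List.map (false ∷_) (allVecs d)) _)
                        (cong₂ ℤ._+_ (∑-map g (false ∷_) (allVecs d)) (∑-map g (true ∷_) (allVecs d)))

∑-allVecs-single : (T : Vec Bool d) {g : Vec Bool d → ℤ} →
                   (∀ S → S ≢ T → g S ≡ + 0) → ∑ g (allVecs d) ≡ g T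
∑-allVecs-single []          {g} _   = ℤ.+-identityʳ (g [])
∑-allVecs-single (false ∷ T) {g} g≡0 = begin
  ∑ g (allVecs _)                                            ≡⟨ ∑-allVecs g ⟩
  ∑ (g ∘ (false ∷_)) (allVecs _) ℤ.+ ∑ (g ∘ (true ∷_)) (allVecs _)
    ≡⟨ cong₂ ℤ._+_ (∑-allVecs-single T (λ S S≢T → g≡0 _ (S≢T ∘ Vec.∷-injectiveʳ)))
                   (∑-zero (λ S → g≡0 (true ∷ S) λ ()) (allVecs _)) ⟩
  g (false ∷ T) ℤ.+ + 0                                      ≡⟨ ℤ.+-identityʳ _ ⟩
  g (false ∷ T)                                              ∎
  where open ≡-Reasoning
∑-allVecs-single (true ∷ T)  {g} g≡0 = begin
  ∑ g (allVecs _)                                            ≡⟨ ∑-allVecs g ⟩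
  ∑ (g ∘ (false ∷_)) (allVecs _) ℤ.+ ∑ (g ∘ (true ∷_)) (allVecs _)
    ≡⟨ cong₂ ℤ._+_ (∑-zero (λ S → g≡0 (false ∷ S) λ ()) (allVecs _))
                   (∑-allVecs-single T (λ S S≢T → g≡0 _ (S≢T ∘ Vec.∷-injectiveʳ))) ⟩
  + 0 ℤ.+ g (true ∷ T)                                       ≡⟨ ℤ.+-identityˡ _ ⟩
  g (true ∷ T)                                               ∎
  where open ≡-Reasoning

≡⇒congruent : ∀ {m x y} → x ≡ y → m Signed.∣ x ℤ.- y
≡⇒congruent {m} {x} refl = subst (m Signed.∣_) (sym (ℤ.+-inverseʳ x)) (∣ᵤ⇒∣ (ℤ.∣ m ∣ ℕ.∣0))

∑-congruent : ∀ {m} {g h : A → ℤ} → (∀ x → m Signed.∣ g x ℤ.- h x) →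
              (xs : List A) → m Signed.∣ ∑ g xs ℤ.- ∑ h xs
∑-congruent g≡h List.[]         = ≡⇒congruent {x = + 0} refl
∑-congruent {g = g} {h} g≡h (x List.∷ xs) =
  subst (_ Signed.∣_) (regroup (g x) (h x) (∑ g xs) (∑ h xs))
        (Signed.∣m∣n⇒∣m+n (g≡h x) (∑-congruent g≡h xs))
  where
  regroup : ∀ a b s t → (a ℤ.- b) ℤ.+ (s ℤ.- t) ≡ (a ℤ.+ s) ℤ.- (b ℤ.+ t)
  regroup = solve-∀

isNonzero : ℤ → ℕ
isNonzero z = if does (z ℤ.≟ + 0) then 0 else 1

isNonzero≤1 : ∀ z → isNonzero z ≤ 1
isNonzero≤1 z with z ℤ.≟ + 0
... | yes _ = z≤n
... | no  _ = s≤s z≤n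

isNonzero-+ : ∀ a b → isNonzero (a ℤ.+ b) ≤ isNonzero a + isNonzero b
isNonzero-+ a b with a ℤ.≟ + 0 | b ℤ.≟ + 0
... | yes refl | yes refl = z≤n
... | yes refl | no  _    = isNonzero≤1 (+ 0 ℤ.+ b)
... | no  _    | _        = ℕ.≤-trans (isNonzero≤1 (a ℤ.+ b)) (ℕ.m≤m+n 1 _)

countNonzero : (A → ℤ) → List A → ℕ
countNonzero h xs = List.length (List.filter (λ x → Dec.¬? (h x ℤ.≟ + 0)) xs)

countNonzero-∷ : (h : A → ℤ) (x : A) (xs : List A) →
                 countNonzero h (x List.∷ xs) ≡ isNonzero (h x) + countNonzero h xs
countNonzero-∷ h x xs with h x ℤ.≟ + 0
... | yes _ = refl
... | no  _ = refl

countNonzero-∑ : (h : A → ℤ) (xs : List A) → + countNonzero h xs ≡ ∑ (λ x → + isNonzero (h x)) xs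
countNonzero-∑ h List.[]         = refl
countNonzero-∑ h (x List.∷ xs) rewrite countNonzero-∷ h x xs =
  trans (ℤ.pos-+ (isNonzero (h x)) _) (cong (ℤ._+_ (+ isNonzero (h x))) (countNonzero-∑ h xs))

countNonzero-+ : (g h : A → ℤ) (xs : List A) →
                 countNonzero (λ x → g x ℤ.+ h x) xs ≤ countNonzero g xs + countNonzero h xs
countNonzero-+ g h List.[]         = z≤n
countNonzero-+ g h (x List.∷ xs)
  rewrite countNonzero-∷ (λ x → g x ℤ.+ h x) x xs | countNonzero-∷ g x xs | countNonzero-∷ h x xs =
  ℕ.≤-trans (ℕ.+-mono-≤ (isNonzero-+ (g x) (h x)) (countNonzero-+ g h xs))
            (ℕ.≤-reflexive (ℕ-interchange (isNonzero (g x)) (isNonzero (h x)) _ _))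
  where open CommutativeSemigroupProperties ℕ.+-commutativeSemigroup
          renaming (interchange to ℕ-interchange)

countNonzero-zero : (xs : List A) → countNonzero (λ _ → + 0) xs ≡ 0
countNonzero-zero List.[]         = refl
countNonzero-zero (_ List.∷ xs) = countNonzero-zero xs

-- Multilinear polynomials

0ₚ : MLPoly d
0ₚ _ = + 0

infixl 6 _+ₚ_
_+ₚ_ : MLPoly d → MLPoly d → MLPoly d
(f +ₚ g) S = f S ℤ.+ g S

monomial : ℤ → Vec Bool d → MLPoly d
monomial c T S = if does (Vec.≡-dec Bool._≟_ S T) then c else + 0

monomial-≢ : ∀ {c} {S T : Vec Bool d} → S ≢ T → monomial c T S ≡ + 0
monomial-≢ {S = S} {T} S≢T with Vec.≡-dec Bool._≟_ S T
... | yes S≡T = contradiction S≡T S≢T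
... | no  _   = refl

monomial-≡ : ∀ c (T : Vec Bool d) → monomial c T T ≡ c
monomial-≡ c T with Vec.≡-dec Bool._≟_ T T
... | yes _   = refl
... | no  T≢T = contradiction refl T≢T

eval-0ₚ : (x : Vec Bool d) → eval 0ₚ x ≡ + 0
eval-0ₚ {d} x = ∑-zero (λ S → ℤ.*-zeroˡ (monoVal S x)) (allVecs d)

eval-+ₚ : (f g : MLPoly d) (x : Vec Bool d) → eval (f +ₚ g) x ≡ eval f x ℤ.+ eval g x
eval-+ₚ {d} f g x = trans (∑-cong (λ S → ℤ.*-distribʳ-+ (monoVal S x) (f S) (g S)) (allVecs d))
                          (∑-+ (λ S → f S ℤ.* monoVal S x) (λ S → g S ℤ.* monoVal S x) (allVecs d))

eval-monomial : ∀ c (T x : Vec Bool d) → eval (monomial c T) x ≡ c ℤ.* monoVal T x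
eval-monomial c T x =
  trans (∑-allVecs-single T λ S S≢T →
           trans (cong (ℤ._* monoVal S x) (monomial-≢ S≢T)) (ℤ.*-zeroˡ (monoVal S x)))
        (cong (ℤ._* monoVal T x) (monomial-≡ c T))

numMonomials-0ₚ : numMonomials (0ₚ {d}) ≡ 0
numMonomials-0ₚ {d} = countNonzero-zero (allVecs d)

numMonomials-+ₚ : (f g : MLPoly d) → numMonomials (f +ₚ g) ≤ numMonomials f + numMonomials g
numMonomials-+ₚ {d} f g = countNonzero-+ f g (allVecs d)

numMonomials-monomial : ∀ c (T : Vec Bool d) → numMonomials (monomial c T) ≤ 1
numMonomials-monomial {d} c T = ℕ.≤-trans (ℕ.≤-reflexive counted) (isNonzero≤1 (monomial c T T))
  where
  counted : numMonomials (monomial c T) ≡ isNonzero (monomial c T T)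
  counted = ℤ.+-injective (trans (countNonzero-∑ (monomial c T) (allVecs d))
    (∑-allVecs-single T (λ S S≢T → cong (λ z → + isNonzero z) (monomial-≢ S≢T))))

characterSum : Vec Bool m → Vec (Vec Bool d) m → MLPoly d
characterSum []      []       = 0ₚ
characterSum (s ∷ ss) (T ∷ Ts) = monomial (pm s) T +ₚ characterSum ss Ts

eval-characterSum : (ss : Vec Bool m) (Ts : Vec (Vec Bool d) m) (x : Vec Bool d) →
                    eval (characterSum ss Ts) x ≡ signSum (ss ⊕ map (_· x) Ts)
eval-characterSum []       []       x = eval-0ₚ x
eval-characterSum (s ∷ ss) (T ∷ Ts) x = begin
  eval (monomial (pm s) T +ₚ characterSum ss Ts) x
    ≡⟨ eval-+ₚ (monomial (pm s) T) _ x ⟩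
  eval (monomial (pm s) T) x ℤ.+ eval (characterSum ss Ts) x
    ≡⟨ cong₂ ℤ._+_ (eval-monomial (pm s) T x) (eval-characterSum ss Ts x) ⟩
  pm s ℤ.* monoVal T x ℤ.+ signSum (ss ⊕ map (_· x) Ts)
    ≡⟨ cong (ℤ._+ signSum (ss ⊕ map (_· x) Ts))
            (trans (cong (ℤ._*_ (pm s)) (monoVal-· T x)) (sym (pm-xor s (T · x)))) ⟩
  pm (s xor T · x) ℤ.+ signSum (ss ⊕ map (_· x) Ts)
    ∎
  where open ≡-Reasoning

numMonomials-characterSum : (ss : Vec Bool m) (Ts : Vec (Vec Bool d) m) →
                            numMonomials (characterSum ss Ts) ≤ m
numMonomials-characterSum {d = d} [] [] = ℕ.≤-reflexive (numMonomials-0ₚ {d})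
numMonomials-characterSum (s ∷ ss) (T ∷ Ts) =
  ℕ.≤-trans (numMonomials-+ₚ (monomial (pm s) T) _)
            (ℕ.+-mono-≤ (numMonomials-monomial (pm s) T) (numMonomials-characterSum ss Ts))

odd-coprime-2 : ∀ k → Coprime (suc (k + k)) 2
odd-coprime-2 zero    = gcd≡1⇒coprime refl
odd-coprime-2 (suc k) = subst (λ m → Coprime m 2) (cong (suc ∘ suc) (sym (ℕ.+-suc k k)))
                              (coprime-+ (odd-coprime-2 k))

∣2*⇒∣ : ∀ {M z} → OddNat M → + M Signed.∣ + 2 ℤ.* z → + M Signed.∣ z
∣2*⇒∣ {z = z} (k , refl) M∣2z = ∣ᵤ⇒∣ (coprime-divisor (+ _) (+ 2) z (odd-coprime-2 k) (∣⇒∣ᵤ M∣2z))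

∣-congruent : ∀ {m x y} → m Signed.∣ x ℤ.- y → m Signed.∣ x → m Signed.∣ y
∣-congruent {x = x} {y} m∣x-y m∣x = subst (_ Signed.∣_) (cancel x y) (Signed.∣m∣n⇒∣m-n m∣x m∣x-y)
  where
  cancel : ∀ x y → x ℤ.- (x ℤ.- y) ≡ y
  cancel = solve-∀

∣-congruent⁻ : ∀ {m x y} → m Signed.∣ x ℤ.- y → m Signed.∣ y → m Signed.∣ x
∣-congruent⁻ {x = x} {y} m∣x-y m∣y = subst (_ Signed.∣_) (cancel x y) (Signed.∣m∣n⇒∣m+n m∣x-y m∣y)
  where
  cancel : ∀ x y → (x ℤ.- y) ℤ.+ y ≡ x
  cancel = solve-∀

∣-swap : ∀ {m x y} → m Signed.∣ x ℤ.- y → m Signed.∣ y ℤ.- x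
∣-swap {x = x} {y} m∣x-y = subst (_ Signed.∣_) (negate x y) (Signed.∣m⇒∣-m m∣x-y)
  where
  negate : ∀ x y → ℤ.- (x ℤ.- y) ≡ y ℤ.- x
  negate = solve-∀

-- 2 is invertible modulo an odd M
∣⇔≡w : ∀ {M e a w} → OddNat M → + M Signed.∣ e ℤ.- + 2 ℤ.* (+ a ℤ.- + w) →
       + M ∣ e ⇔ w ≡w a [mod M ]
∣⇔≡w {M} {e} {a} {w} odd e≡2[a-w] = mk⇔ to from
  where
  to : + M ∣ e → w ≡w a [mod M ]
  to M∣e = ∣⇒∣ᵤ (∣-swap {x = + a} {+ w}
                  (∣2*⇒∣ odd (∣-congruent {x = e} e≡2[a-w] (∣ᵤ⇒∣ {+ M} {e} M∣e))))
  from : w ≡w a [mod M ] → + M ∣ e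
  from w≡a = ∣⇒∣ᵤ (∣-congruent⁻ {x = e} e≡2[a-w]
                    (Signed.∣n⇒∣m*n (+ 2) (∣-swap {x = + w} {+ a} (∣ᵤ⇒∣ w≡a))))

-- From an affine subspace to a representation of OR, and back

OR-representation : ∀ {M} → OddNat M → Good n M d →
                    Σ (MLPoly d) λ f → numMonomials f ≤ n + 1 × RepresentsOR d M f
OR-representation {n} {d} {M} odd (C , a , _ , x₀ , (c₀ , x₀≡) , x₀≡a , unique) =
  f , size , M∣f[1] , M∤f[x]
  where
  open AffSub C

  K : ℤ
  K = + 2 ℤ.* + a ℤ.- + n

  f : MLPoly d
  f = monomial K (zeroV d) +ₚ characterSum x₀ (transpose dirs)

  size : numMonomials f ≤ n + 1
  size = ℕ.≤-trans (numMonomials-+ₚ (monomial K (zeroV d)) (characterSum x₀ (transpose dirs)))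
           (ℕ.≤-trans (ℕ.+-mono-≤ (numMonomials-monomial K (zeroV d))
                                  (numMonomials-characterSum x₀ (transpose dirs)))
                      (ℕ.≤-reflexive (ℕ.+-comm 1 n)))

  point : Vec Bool d → Vec Bool n
  point x = x₀ ⊕ lincomb x dirs

  point∈C : ∀ x → point x ∈A C
  point∈C x = c₀ ⊕ x , (begin
    x₀ ⊕ lincomb x dirs                         ≡⟨ cong (_⊕ lincomb x dirs) x₀≡ ⟩
    (base ⊕ lincomb c₀ dirs) ⊕ lincomb x dirs   ≡⟨ 𝔽₂.assoc base _ _ ⟩
    base ⊕ (lincomb c₀ dirs ⊕ lincomb x dirs)   ≡⟨ cong (base ⊕_) (sym (lincomb-⊕ c₀ x dirs)) ⟩
    base ⊕ lincomb (c₀ ⊕ x) dirs                ∎)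
    where open ≡-Reasoning

  -- ones d is zeroV d: the point 𝟏 of {−1,1}ᵈ is the origin of 𝔽₂ᵈ
  point-ones : point (ones d) ≡ x₀
  point-ones = trans (cong (x₀ ⊕_) (lincomb-zero dirs)) (𝔽₂.identityʳ x₀)

  eval-f : ∀ x → eval f x ≡ + 2 ℤ.* (+ a ℤ.- + weight (point x))
  eval-f x = begin
    eval f x
      ≡⟨ eval-+ₚ (monomial K (zeroV d)) (characterSum x₀ (transpose dirs)) x ⟩
    eval (monomial K (zeroV d)) x ℤ.+ eval (characterSum x₀ (transpose dirs)) x
      ≡⟨ cong₂ ℤ._+_ (trans (eval-monomial K (zeroV d) x) (cong (ℤ._*_ K) (monoVal-zeroV x)))
                     (eval-characterSum x₀ (transpose dirs) x) ⟩
    K ℤ.* + 1 ℤ.+ signSum (x₀ ⊕ map (_· x) (transpose dirs))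
      ≡⟨ cong (λ v → K ℤ.* + 1 ℤ.+ signSum (x₀ ⊕ v)) (sym (lincomb≡map-·-transpose x dirs)) ⟩
    K ℤ.* + 1 ℤ.+ signSum (point x)
      ≡⟨ cong (ℤ._+_ (K ℤ.* + 1)) (signSum-weight (point x)) ⟩
    K ℤ.* + 1 ℤ.+ (+ n ℤ.- + 2 ℤ.* + weight (point x))
      ≡⟨ collect (+ a) (+ n) (+ weight (point x)) ⟩
    + 2 ℤ.* (+ a ℤ.- + weight (point x)) ∎
    where
    open ≡-Reasoning
    collect : ∀ a n w → (+ 2 ℤ.* a ℤ.- n) ℤ.* + 1 ℤ.+ (n ℤ.- + 2 ℤ.* w) ≡ + 2 ℤ.* (a ℤ.- w)
    collect = solve-∀

  M∣f⇔ : ∀ x → + M ∣ eval f x ⇔ weight (point x) ≡w a [mod M ]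
  M∣f⇔ x = ∣⇔≡w {e = eval f x} {a} {weight (point x)} odd (≡⇒congruent (eval-f x))

  M∣f[1] : + M ∣ eval f (ones d)
  M∣f[1] = Equivalence.from (M∣f⇔ (ones d))
                            (subst (λ v → weight v ≡w a [mod M ]) (sym point-ones) x₀≡a)

  M∤f[x] : ∀ x → x ≢ ones d → ¬ (+ M ∣ eval f x)
  M∤f[x] x x≢1 M∣fx = x≢1 (indep x (𝔽₂.∙-cancelˡ x₀ (lincomb x dirs) (zeroV n)
    (trans (unique (point x) (point∈C x) (Equivalence.to (M∣f⇔ x) M∣fx)) (sym (𝔽₂.identityʳ x₀)))))

repeatEach : (r : A → ℕ) (xs : List A) → Vec A (sum (List.map r xs))
repeatEach r List.[]         = []
repeatEach r (x List.∷ xs) = replicate (r x) x ++ repeatEach r xs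

signSum-repeatEach : (g : A → Bool) (r : A → ℕ) (xs : List A) →
                     signSum (map g (repeatEach r xs)) ≡ ∑ (λ x → + r x ℤ.* pm (g x)) xs
signSum-repeatEach g r List.[]         = refl
signSum-repeatEach g r (x List.∷ xs) = begin
  signSum (map g (replicate (r x) x ++ repeatEach r xs))
    ≡⟨ cong signSum (Vec.map-++ g (replicate (r x) x) (repeatEach r xs)) ⟩
  signSum (map g (replicate (r x) x) ++ map g (repeatEach r xs))
    ≡⟨ signSum-++ (map g (replicate (r x) x)) _ ⟩
  signSum (map g (replicate (r x) x)) ℤ.+ signSum (map g (repeatEach r xs))
    ≡⟨ cong₂ ℤ._+_ (trans (cong signSum (Vec.map-replicate g x (r x))) (signSum-replicate (r x) (g x)))
                   (signSum-repeatEach g r xs) ⟩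
  + r x ℤ.* pm (g x) ℤ.+ ∑ (λ x → + r x ℤ.* pm (g x)) xs ∎
  where open ≡-Reasoning

-- f ≡ ∑ₛ rₛ·χₛ (mod M) with 0 ≤ rₛ < M; listing each S exactly rₛ times turns
-- the right-hand side into the sign sum of a single vector of length ∑ₛ rₛ.
module CoefficientReduction (M : ℕ) .{{_ : NonZero M}} {d : ℕ} (f : MLPoly d) where

  residue : Vec Bool d → ℕ
  residue S = f S %ℕ M

  width : ℕ
  width = sum (List.map residue (allVecs d))

  columns : Vec (Vec Bool d) width
  columns = repeatEach residue (allVecs d)

  residue-congruent : ∀ S → + M Signed.∣ f S ℤ.- + residue S
  residue-congruent S = Signed.divides (f S /ℕ M)
    (trans (cong (ℤ._- + residue S) (a≡a%ℕn+[a/ℕn]*n (f S) M)) (cancel (+ residue S) _))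
    where
    cancel : ∀ r t → (r ℤ.+ t) ℤ.- r ≡ t
    cancel = solve-∀

  residue≤ : ∀ S → residue S ≤ M * isNonzero (f S)
  residue≤ S with f S ℤ.≟ + 0
  ... | yes f[S]≡0 rewrite f[S]≡0 = ℕ.≤-reflexive (trans (m*n%n≡0 0 M) (sym (ℕ.*-zeroʳ M)))
  ... | no  _      = ℕ.≤-trans (ℕ.<⇒≤ (n%ℕd<d (f S) M)) (ℕ.≤-reflexive (sym (ℕ.*-identityʳ M)))

  width≤ : width ≤ M * numMonomials f
  width≤ = bound (allVecs d)
    where
    bound : (xs : List (Vec Bool d)) → sum (List.map residue xs) ≤ M * countNonzero f xs
    bound List.[]         = z≤n
    bound (S List.∷ xs) rewrite countNonzero-∷ f S xs =
      ℕ.≤-trans (ℕ.+-mono-≤ (residue≤ S) (bound xs)) (ℕ.≤-reflexive (sym (ℕ.*-distribˡ-+ M _ _)))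

  eval-congruent : ∀ y → + M Signed.∣ eval f y ℤ.- signSum (map (_· y) columns)
  eval-congruent y =
    subst (λ z → + M Signed.∣ eval f y ℤ.- z) (sym (signSum-repeatEach (_· y) residue (allVecs d)))
          (∑-congruent termwise (allVecs d))
    where
    termwise : ∀ S → + M Signed.∣ f S ℤ.* monoVal S y ℤ.- + residue S ℤ.* pm (S · y)
    termwise S rewrite monoVal-· S y =
      subst (_ Signed.∣_) (distrib (f S) (+ residue S) (pm (S · y)))
            (Signed.∣m⇒∣m*n (pm (S · y)) (residue-congruent S))
      where
      distrib : ∀ a b c → (a ℤ.- b) ℤ.* c ≡ a ℤ.* c ℤ.- b ℤ.* c
      distrib = solve-∀

Good-from-OR : ∀ {M d} .{{_ : NonZero M}} → OddNat M → (f : MLPoly d) → RepresentsOR d M f →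
               Good (CoefficientReduction.width M f) M d
Good-from-OR {M} {d} odd f (M∣f[1] , M∤f[x]) =
  C , 0 , z≤n , point (ones d) , (ones d , refl) , weight-ones , unique
  where
  open CoefficientReduction M f

  point : Vec Bool d → Vec Bool width
  point c = zeroV width ⊕ lincomb c (transpose columns)

  point≡ : ∀ c → point c ≡ map (_· c) columns
  point≡ c = trans (𝔽₂.identityˡ _) (lincomb-transpose c columns)

  point-ones : point (ones d) ≡ zeroV width
  point-ones = trans (cong (zeroV width ⊕_) (lincomb-zero (transpose columns))) (𝔽₂.identityˡ _)

  M∣width : + M Signed.∣ + width
  M∣width = subst (_ Signed.∣_) signSum-ones
                  (∣-congruent {x = eval f (ones d)} (eval-congruent (ones d)) (∣ᵤ⇒∣ M∣f[1]))
    where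
    signSum-ones : signSum (map (_· ones d) columns) ≡ + width
    signSum-ones = trans (cong signSum (trans (sym (point≡ (ones d))) point-ones)) (signSum-zeroV width)

  M∣f⇔ : ∀ c → + M ∣ eval f c ⇔ weight (point c) ≡w 0 [mod M ]
  M∣f⇔ c = ∣⇔≡w {e = eval f c} {0} {weight (point c)} odd
    (subst (_ Signed.∣_) (regroup (eval f c) (+ width) (+ weight (point c)))
           (Signed.∣m∣n⇒∣m+n f≡signSum M∣width))
    where
    f≡signSum : + M Signed.∣ eval f c ℤ.- (+ width ℤ.- + 2 ℤ.* + weight (point c))
    f≡signSum = subst (λ z → + M Signed.∣ eval f c ℤ.- z)
                      (trans (cong signSum (sym (point≡ c))) (signSum-weight (point c)))
                      (eval-congruent c)
    regroup : ∀ e n w → (e ℤ.- (n ℤ.- + 2 ℤ.* w)) ℤ.+ n ≡ e ℤ.- + 2 ℤ.* (+ 0 ℤ.- w)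
    regroup = solve-∀

  ones-unique : ∀ c → weight (point c) ≡w 0 [mod M ] → c ≡ ones d
  ones-unique c wt≡0 = decidable-stable (Vec.≡-dec Bool._≟_ c (ones d))
    (λ c≢1 → M∤f[x] c c≢1 (Equivalence.from (M∣f⇔ c) wt≡0))

  weight-ones : weight (point (ones d)) ≡w 0 [mod M ]
  weight-ones = Equivalence.to (M∣f⇔ (ones d)) M∣f[1]

  C : AffSub width d
  C = record
    { base  = zeroV width
    ; dirs  = transpose columns
    ; indep = λ c lc≡0 → ones-unique c (subst (λ v → weight v ≡w 0 [mod M ])
                (sym (cong (zeroV width ⊕_) (trans lc≡0 (sym (lincomb-zero (transpose columns))))))
                weight-ones)
    }

  unique : ∀ y → y ∈A C → weight y ≡w 0 [mod M ] → y ≡ point (ones d)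
  unique y (c , y≡) wt≡0 =
    trans y≡ (cong point (ones-unique c (subst (λ v → weight v ≡w 0 [mod M ]) y≡ wt≡0)))

-- Existence of 𝒟(n, M)

Vec↔Fin : A ↔ Fin m → ∀ n → Vec A n ↔ Fin (m ^ n)
Vec↔Fin A↔Fin zero    =
  mk↔ₛ′ (λ _ → Fin.zero) (λ _ → []) (λ { Fin.zero → refl ; (Fin.suc ()) }) (λ { [] → refl })
Vec↔Fin A↔Fin (suc n) = ↔-trans uncons (↔-trans (A↔Fin ×-↔ Vec↔Fin A↔Fin n) (↔-sym *↔×))
  where
  uncons : Vec _ (suc n) ↔ (_ × Vec _ n)
  uncons = mk↔ₛ′ (λ { (x ∷ xs) → x , xs }) (λ (x , xs) → x ∷ xs) (λ _ → refl) (λ { (x ∷ xs) → refl })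

Bool^↔Fin : ∀ n → Vec Bool n ↔ Fin (2 ^ n)
Bool^↔Fin = Vec↔Fin (↔-sym 2↔Bool)

module _ {m} (A↔Fin : A ↔ Fin m) where
  open Inverse A↔Fin

  ∃? : {P : Pred A 0ℓ} → Decidable P → Dec (∃ P)
  ∃? {P} P? = Dec.map′ (λ (i , p) → from i , p)
                       (λ (x , p) → to x , subst P (sym (strictlyInverseʳ x)) p)
                       (any? (P? ∘ from))

  ∀? : {P : Pred A 0ℓ} → Decidable P → Dec (∀ x → P x)
  ∀? {P} P? = Dec.map′ (λ ∀P x → subst P (strictlyInverseʳ x) (∀P (to x)))
                       (λ ∀P i → ∀P (from i))
                       (all? (P? ∘ from))

∃≤? : ∀ B {P : Pred ℕ 0ℓ} → Decidable P → Dec (Σ ℕ λ a → a ≤ B × P a)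
∃≤? B {P} P? = Dec.map′ (λ (i , p) → toℕ i , toℕ≤pred[n] i , p)
                        (λ (a , a≤B , p) → fromℕ< (s≤s a≤B) , subst P (sym (toℕ-fromℕ< (s≤s a≤B))) p)
                        (any? {n = suc B} (P? ∘ toℕ))

Bool^-injective⇒≤ : (g : Vec Bool k → Vec Bool n) → (∀ {c c′} → g c ≡ g c′ → c ≡ c′) → k ≤ n
Bool^-injective⇒≤ {k} {n} g g-injective = ℕ.≮⇒≥ λ n<k →
  ℕ.<⇒≱ (ℕ.^-monoʳ-< 2 (s≤s (s≤s z≤n)) n<k)
        (injective⇒≤ {f = Inverse.to (Bool^↔Fin n) ∘ g ∘ Inverse.from (Bool^↔Fin k)}
                     (λ eq → injective (↔-sym (Bool^↔Fin k))
                                       (g-injective (injective (Bool^↔Fin n) eq))))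
  where
  injective : ∀ {A B : Set} (A↔B : A ↔ B) → ∀ {x y} → Inverse.to A↔B x ≡ Inverse.to A↔B y → x ≡ y
  injective A↔B = Injection.injective (↔⇒↣ A↔B)

AffSub-dim≤ : AffSub n k → k ≤ n
AffSub-dim≤ C =
  Bool^-injective⇒≤ (λ c → lincomb c (AffSub.dirs C)) (lincomb-injective (AffSub.indep C))

Independent : Vec (Vec Bool n) k → Set
Independent {n} {k} bs = ∀ c → lincomb c bs ≡ zeroV n → c ≡ zeroV k

Independent? : (bs : Vec (Vec Bool n) k) → Dec (Independent bs)
Independent? {n} {k} bs = ∀? (Bool^↔Fin k) λ c →
  Vec.≡-dec Bool._≟_ (lincomb c bs) (zeroV n) →-dec Vec.≡-dec Bool._≟_ c (zeroV k)

HasUniqueResiduePoint : ℕ → AffSub n k → Set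
HasUniqueResiduePoint {n} M C =
  Σ ℕ λ a → a ≤ M × Σ (Vec Bool n) λ x₀ → x₀ ∈A C × weight x₀ ≡w a [mod M ] ×
    (∀ y → y ∈A C → weight y ≡w a [mod M ] → y ≡ x₀)

HasUniqueResiduePoint? : ∀ M (C : AffSub n k) → Dec (HasUniqueResiduePoint M C)
HasUniqueResiduePoint? {n} M C = ∃≤? M λ a → ∃? (Bool^↔Fin n) λ x₀ →
  ∈C? x₀ ×-dec ≡w? x₀ a ×-dec
  ∀? (Bool^↔Fin n) λ y → ∈C? y →-dec ≡w? y a →-dec Vec.≡-dec Bool._≟_ y x₀
  where
  ∈C? : ∀ x → Dec (x ∈A C)
  ∈C? x = ∃? (Bool^↔Fin _) λ c → Vec.≡-dec Bool._≟_ x (AffSub.base C ⊕ lincomb c (AffSub.dirs C))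
  ≡w? : ∀ x a → Dec (weight x ≡w a [mod M ])
  ≡w? x a = M ℕ.∣? ℤ.∣ + weight x ℤ.- + a ∣

Good? : ∀ n M k → Dec (Good n M k)
Good? n M k = Dec.map′ (λ (b , bs , ind , h) → affSub b bs ind , h)
                       (λ (C , h) → AffSub.base C , AffSub.dirs C , AffSub.indep C , h)
                       (∃? (Bool^↔Fin n) λ b → ∃? (Vec↔Fin (Bool^↔Fin n) k) λ bs → Σ-Independent? b bs)
  where
  affSub : ∀ b bs → Independent bs → AffSub n k
  affSub b bs ind = record { base = b ; dirs = bs ; indep = ind }

  -- HasUniqueResiduePoint only inspects base and dirs, so proj₂ needs no transport
  Σ-Independent? : ∀ b bs → Dec (Σ (Independent bs) λ ind → HasUniqueResiduePoint M (affSub b bs ind))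
  Σ-Independent? b bs with Independent? bs
  ... | yes ind = Dec.map′ (ind ,_) proj₂ (HasUniqueResiduePoint? M (affSub b bs ind))
  ... | no ¬ind = no (¬ind ∘ proj₁)

module _ {P : Pred ℕ 0ℓ} (P? : Decidable P) where

  largest≤ : ∀ B {d} → P d → d ≤ B → Σ ℕ λ e → P e × d ≤ e × (∀ {k} → P k → k ≤ B → k ≤ e)
  largest≤ B       pd d≤B with P? B
  ... | yes pB = B , pB , d≤B , λ _ k≤B → k≤B
  largest≤ zero    pd z≤n | no ¬p0 = contradiction pd ¬p0
  largest≤ (suc B) pd d≤B | no ¬pB =
    let e , pe , d≤e , maximal = largest≤ B pd (below pd d≤B)
    in  e , pe , d≤e , λ pk k≤B → maximal pk (below pk k≤B)
    where
    below : ∀ {k} → P k → k ≤ suc B → k ≤ B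
    below pk k≤ = ℕ.s≤s⁻¹ (ℕ.≤∧≢⇒< k≤ λ { refl → ¬pB pk })

  maximum : ∀ {B d} → (∀ {k} → P k → k ≤ B) → P d →
            Σ ℕ λ e → (P e × (∀ k → P k → k ≤ e)) × d ≤ e
  maximum {B} bounded pd =
    let e , pe , d≤e , maximal = largest≤ B pd (bounded pd)
    in  e , (pe , λ k pk → maximal pk (bounded pk)) , d≤e

proposition4p16 : ∀ (M : ℕ) → OddNat M →
    ((n : ℕ) → 1 ≤ n → (d : ℕ) → IsD n M d →
      Σ (MLPoly d) λ f → numMonomials f ≤ n + 1 × RepresentsOR d M f)
    ×
    ((n d : ℕ) → (f : MLPoly d) → numMonomials f ≡ n → RepresentsOR d M f →
      Σ ℕ λ n' → n' ≤ M * n × Σ ℕ λ e → IsD n' M e × d ≤ e)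
proposition4p16 M odd@(_ , refl) =
  (λ n _ d (good , _) → OR-representation odd good) ,
  λ { n d f refl rep → let open CoefficientReduction M f in
        width , width≤ , maximum (Good? width M) (AffSub-dim≤ ∘ proj₁) (Good-from-OR odd f rep) }
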